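{- In the combinatorial Marker-Cutter game, let $(D_k,\chi_k,g_k)$ be a game state and let $C$ be a directed cycle of $D_k$ carrying an isolated label $a$. Suppose Marker chooses vertices $v,w\in V(C)$ which gather $a$, and that $a$ occurs as a label on $\hat C_1$. Then move (c) is not a legal move for restricted Cutter.
   Context: A set of boundary cycles is a pair $(D,\chi)$: $D$ a finite directed graph each of whose components is a directed cycle (loops allowed, no isolated vertices), $\chi:E(D)\to L$ an edge labelling; proper if each label is used on at most two edges. A label is isolated if it appears on only one component (cycle) of $D$. A game state is $(D,\chi,g)$ with $(D,\chi)$ proper, $g\in\mathbb N_0$; its value is the number of labels used. Game moves: at turn $k$ with state $(D_k,\chi_k,g_k)$, Marker chooses $v,w$ (not necessarily distinct) from $V(D_k)$ or dummy vertices. Splitting a vertex $u$ replaces it by a source $u_1$ (incident to the out-edge) and a sink $u_2$ (incident to the in-edge). If $v,w$ lie on the same cycle $C$: splitting turns $C$ into a directed path $P$ from $v_1$ to $w_2$ and a directed path $P'$ from $w_1$ to $v_2$; add new edges $f=\overrightarrow{w_2v_1}$, $f'=\overrightarrow{v_2w_1}$; $\hat C_1=P\cup\{f\}$, $\hat C_2=P'\cup\{f'\}$. Cutter chooses (a) $D_{k+1}=\bar D\cup\hat C_1\cup\hat C_2$, $g_{k+1}=g_k-1$ (only if $g_k\ge1$); (b) $D_{k+1}=\bar D\cup\hat C_1$, $g_{k+1}=\bar g$; or (c) $D_{k+1}=\bar D\cup\hat C_2$, $g_{k+1}=\bar g$; with $\bar D$ a union of components of $D_k\setminus C$, $0\le\bar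 g\le g_k$. (If $v,w$ lie on different cycles $C,C'$, the only move (d) merges them: $C\to$ path $P$ from $v_1$ to $v_2$, $C'\to P'$ from $w_1$ to $w_2$, $\hat C=P\cup P'\cup\{\overrightarrow{w_2v_1},\overrightarrow{v_2w_1}\}$ replaces $C\cup C'$, $g$ unchanged.) New edges get one common new label; old labels are kept. The vertices $v,w\in V(C)$ gather $a$ if the label $a$ occurs only on one of the two segments of $C$ between $v$ and $w$. A contraction contracts one edge (deleting resulting isolated vertices). $(D',\chi',g')$ is a reduction of $(D,\chi,g)$ if $g'\le g$, $D'$ is obtained from $D$ by contractions and $\chi'=\chi$ on $E(D')$. Game states are equivalent if they are isomorphic as labelled digraphs up to a bijective relabelling and have equal counters. Restricted Cutter may never make a move producing a game state equivalent to a reduction of an earlier game state (including the current one), and in moves (a), (b), (c) must take $\bar D=D_k\setminus C$ and $\bar g=g_k$. -}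

module Defs where

open import Data.Nat using (ℕ; zero; suc; _+_; _∸_; _≤_; _<_; _<ᵇ_)
open import Data.Nat.Properties using (_≟_)
open import Data.Bool using (if_then_else_)
open import Data.Fin using (Fin; toℕ)
open import Data.List using (List; []; _∷_; _++_; [_]; length; lookup; take; drop;
  concat; map; filter; removeAt; updateAt)
open import Data.List.Membership.Propositional using (_∈_; _∉_)
open import Data.List.Relation.Unary.All using (All)
open import Data.List.Relation.Binary.Permutation.Propositional using (_↭_)
open import Data.List.Relation.Binary.Pointwise using (Pointwise)
open import Data.Product using (Σ; ∃; _×_; _,_)
open import Data.Sum using (_⊎_)
open import Relation.Binary.PropositionalEquality using (_≡_; _≢_)
open import Relation.Binary.Construct.Closure.ReflexiveTransitive using (Star)
open import Relation.Nullary using (¬_)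
open import Function.Definitions using (Injective)

-- A finite digraph all of whose components are directed cycles, with an
-- edge labelling χ into the label set ℕ, is encoded as a list of cycles;
-- each cycle is the (nonempty) list of the labels of its edges in the
-- cyclic order of the directed cycle.  Vertex number p of a cycle c is
-- the tail of edge p (and the head of edge p-1, cyclically).  Isomorphism
-- of labelled digraphs is then: permuting the cycles and rotating each
-- cycle (see _≅_ below).

Label : Set
Label = ℕ

Cycle : Set
Cycle = List Label

Cycles : Set
Cycles = List Cycle

-- every component is a genuine cycle (at least one edge, no isolated vertex)
WellFormed : Cycles → Set
WellFormed D = All (λ c → c ≢ []) D

occurrences : Label → Cycles → ℕ
occurrences ℓ D = length (filter (_≟ ℓ) (concat D))

Proper : Cycles → Set
Proper D = ∀ ℓ → occurrences ℓ D ≤ 2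

record State : Set where
  constructor ⟨_,_⟩
  field
    cycles  : Cycles
    counter : ℕ
open State public

IsGameState : State → Set
IsGameState s = WellFormed (cycles s) × Proper (cycles s)

IsolatedOn : (D : Cycles) → Fin (length D) → Label → Set
IsolatedOn D i a = a ∈ lookup D i × (∀ j → j ≢ i → a ∉ lookup D j)

rotate : ℕ → Cycle → Cycle
rotate k c = drop k c ++ take k c

-- number of edges of the segment P from v to w (from the out-edge of v
-- to the in-edge of w); if v = w this segment is the whole cycle and the
-- other segment P' is trivial (no edges).
segLen : ℕ → ℕ → ℕ → ℕ
segLen L p q = if p <ᵇ q then q ∸ p else L ∸ (p ∸ q)

segP : (c : Cycle) → Fin (length c) → Fin (length c) → List Label
segP c p q = take (segLen (length c) (toℕ p) (toℕ q)) (rotate (toℕ p) c)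

segP' : (c : Cycle) → Fin (length c) → Fin (length c) → List Label
segP' c p q =
  take (length c ∸ segLen (length c) (toℕ p) (toℕ q)) (rotate (toℕ q) c)

-- Ĉ₁ = P ∪ {f},  Ĉ₂ = P' ∪ {f'}, the new edges carrying the new label b
Ĉ₁ : (c : Cycle) → Fin (length c) → Fin (length c) → Label → Cycle
Ĉ₁ c p q b = segP c p q ++ [ b ]

Ĉ₂ : (c : Cycle) → Fin (length c) → Fin (length c) → Label → Cycle
Ĉ₂ c p q b = segP' c p q ++ [ b ]

Gather : (c : Cycle) → Fin (length c) → Fin (length c) → Label → Set
Gather c p q a = (a ∈ segP c p q × a ∉ segP' c p q)
               ⊎ (a ∉ segP c p q × a ∈ segP' c p q)

moveC : (s : State) (i : Fin (length (cycles s)))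
        (p q : Fin (length (lookup (cycles s) i))) → Label → State
moveC s i p q b =
  ⟨ Ĉ₂ (lookup (cycles s) i) p q b ∷ removeAt (cycles s) i , counter s ⟩

-- contract edge number p of cycle i (deleting the vertex if it becomes
-- isolated, i.e. deleting the cycle if it was a loop)
contract : (D : Cycles) (i : Fin (length D)) → Fin (length (lookup D i)) → Cycles
contract D i p with removeAt (lookup D i) p
... | []     = removeAt D i
... | c ∷ cs = updateAt D i (λ _ → c ∷ cs)

ContractStep : Cycles → Cycles → Set
ContractStep D D' = Σ (Fin (length D)) λ i →
  Σ (Fin (length (lookup D i))) λ p → D' ≡ contract D i p

Reduction : State → State → Set
Reduction s s' = counter s' ≤ counter s × Star ContractStep (cycles s) (cycles s')

RotEq : Cycle → Cycle → Set
RotEq c c' = ∃ λ k → rotate k c ≡ c'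

_≅_ : Cycles → Cycles → Set
D ≅ D' = ∃ λ E → (D ↭ E) × Pointwise RotEq E D'

Equivalent : State → State → Set
Equivalent s t = counter s ≡ counter t ×
  (∃ λ (ρ : Label → Label) → Injective _≡_ _≡_ ρ × (map (map ρ) (cycles s) ≅ cycles t))

Forbidden : List State → State → Set
Forbidden history s' = ∃ λ t → t ∈ history × ∃ λ r → Reduction t r × Equivalent s' r

LegalForRestricted : List State → State → Set
LegalForRestricted history s' = ¬ Forbidden history s'

-- Relabel by the transposition of a and the fresh label b; as a is isolated
-- on C and b is unused, this only turns the new edge of Ĉ₂ into an a-edge.
-- Since v, w gather a and a lies on Ĉ₁, a lies on P but not on P′, so
-- P′ followed by an a-edge is, up to rotation, a sublist of C.  Contracting
-- the remaining edges of C therefore yields a reduction of the current state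
-- equivalent to the outcome of move (c).

module Submission where

open import Defs
open import Data.List using (List; _∷_; length; lookup; concat)
open import Data.Fin using (Fin)
open import Data.List.Membership.Propositional using (_∈_; _∉_)
open import Relation.Nullary using (¬_)

open import Data.Empty using (⊥-elim)
open import Data.Fin using (zero; suc; toℕ)
open import Data.Fin.Properties using (suc-injective)
open import Data.List using ([]; _++_; [_]; take; drop; map; removeAt)
open import Data.List.Properties
  using (take++drop≡id; ++-conicalˡ; ++-conicalʳ; ++-identityʳ; map-++; map-id-local)
open import Data.List.Membership.Propositional.Properties
  using (∈-++⁻; ∈-concat⁺′; ∈-lookup)
open import Data.List.Relation.Unary.All using (tabulate)
open import Data.List.Relation.Unary.Any using (here)
open import Data.List.Relation.Binary.Permutation.Propositional
  using (_↭_; ↭-sym; ↭-trans; ↭-reflexive)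
open import Data.List.Relation.Binary.Permutation.Propositional.Properties
  using (∈-resp-↭; ++-comm; shift)
import Data.List.Relation.Binary.Pointwise as Pointwise
open import Data.List.Relation.Binary.Sublist.Propositional
  using (_⊆_; []; _∷_; _∷ʳ_; ⊆-refl; from∈)
open import Data.List.Relation.Binary.Sublist.Propositional.Properties
  using (++⁺; take-⊆; Any-resp-⊆)
open import Data.Nat.Properties using (_≟_; ≤-refl)
open import Data.Product using (Σ; ∃; ∃₂; _×_; _,_)
import Data.Product as Product
open import Data.Sum using (inj₁; inj₂)
open import Function using (_∘_; id)
open import Function.Definitions using (Injective)
open import Relation.Binary.Construct.Closure.ReflexiveTransitive using (Star; ε; _◅_; gmap)
open import Relation.Binary.PropositionalEquality
  using (_≡_; _≢_; refl; sym; trans; cong; cong₂; subst; module ≡-Reasoning)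
open import Relation.Nullary using (yes; no)

private
  variable
    A : Set

take-length-++ : (xs ys : List A) → take (length xs) (xs ++ ys) ≡ xs
take-length-++ []       ys = refl
take-length-++ (x ∷ xs) ys = cong (x ∷_) (take-length-++ xs ys)

drop-length-++ : (xs ys : List A) → drop (length xs) (xs ++ ys) ≡ ys
drop-length-++ []       ys = refl
drop-length-++ (x ∷ xs) ys = drop-length-++ xs ys

rotate-length-++ : (xs ys : Cycle) → rotate (length xs) (xs ++ ys) ≡ ys ++ xs
rotate-length-++ xs ys = cong₂ _++_ (drop-length-++ xs ys) (take-length-++ xs ys)

rotate-↭ : ∀ k (c : Cycle) → rotate k c ↭ c
rotate-↭ k c = ↭-trans (++-comm (drop k c) (take k c)) (↭-reflexive (take++drop≡id k c))

∈-rotate⁺ : ∀ k {c : Cycle} {x} → x ∈ c → x ∈ rotate k c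
∈-rotate⁺ k {c} = ∈-resp-↭ (↭-sym (rotate-↭ k c))

rotate-≢[] : ∀ k {c : Cycle} → c ≢ [] → rotate k c ≢ []
rotate-≢[] k {c} c≢[] eq = c≢[] (begin
  c                     ≡⟨ take++drop≡id k c ⟨
  take k c ++ drop k c  ≡⟨ cong₂ _++_ (++-conicalʳ (drop k c) _ eq) (++-conicalˡ _ (take k c) eq) ⟩
  []                    ∎)
  where open ≡-Reasoning

RotEq-≢[] : ∀ {c c′} → RotEq c c′ → c ≢ [] → c′ ≢ []
RotEq-≢[] (k , refl) c≢[] = rotate-≢[] k c≢[]

++-[x]-≢[] : ∀ (xs : List A) {x} → xs ++ [ x ] ≢ []
++-[x]-≢[] xs eq with ++-conicalʳ xs _ eq
... | ()

RotEq-refl : (c : Cycle) → RotEq c c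
RotEq-refl c = 0 , ++-identityʳ c

⊆[]⇒≡[] : {xs : List A} → xs ⊆ [] → xs ≡ []
⊆[]⇒≡[] [] = refl

++-⊆-split : (xs ys : List A) {zs : List A} → zs ⊆ xs ++ ys →
  ∃₂ λ us vs → zs ≡ us ++ vs × us ⊆ xs × vs ⊆ ys
++-⊆-split []       ys τ = [] , _ , refl , [] , τ
++-⊆-split (x ∷ xs) ys (.x ∷ʳ τ) with ++-⊆-split xs ys τ
... | us , vs , refl , us⊆xs , vs⊆ys = us , vs , refl , x ∷ʳ us⊆xs , vs⊆ys
++-⊆-split (x ∷ xs) ys (refl ∷ τ) with ++-⊆-split xs ys τ
... | us , vs , refl , us⊆xs , vs⊆ys = x ∷ us , vs , refl , refl ∷ us⊆xs , vs⊆ys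

⊆-rotate : ∀ k (c : Cycle) {xs} → xs ⊆ rotate k c → ∃ λ ys → ys ⊆ c × RotEq xs ys
⊆-rotate k c τ with ++-⊆-split (drop k c) (take k c) τ
... | us , vs , refl , us⊆ , vs⊆ =
  vs ++ us , subst (vs ++ us ⊆_) (take++drop≡id k c) (++⁺ vs⊆ us⊆) , length us , rotate-length-++ us vs

take-++-∷-⊆ : ∀ n {x : A} xs → x ∉ take n xs → x ∈ xs → take n xs ++ [ x ] ⊆ xs
take-++-∷-⊆ n {x} xs x∉take x∈xs with ∈-++⁻ (take n xs) (subst (x ∈_) (sym (take++drop≡id n xs)) x∈xs)
... | inj₁ x∈take = ⊥-elim (x∉take x∈take)
... | inj₂ x∈drop = subst (take n xs ++ [ x ] ⊆_) (take++drop≡id n xs) (++⁺ ⊆-refl (from∈ x∈drop))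

-- The side condition c′ ≢ [] excludes contracting a loop, which would delete
-- the whole cycle instead of shortening it.
Deletion : Cycle → Cycle → Set
Deletion c c′ = Σ (Fin (length c)) λ p → removeAt c p ≡ c′ × c′ ≢ []

deletion-∷ : ∀ x {c c′} → Deletion c c′ → Deletion (x ∷ c) (x ∷ c′)
deletion-∷ x (p , refl , _) = suc p , refl , λ ()

deletions-after : ∀ x {ys zs} → ys ⊆ zs → Star Deletion (x ∷ zs) (x ∷ ys)
deletions-after x []         = ε
deletions-after x (z ∷ʳ τ)   = (suc zero , refl , λ ()) ◅ deletions-after x τ
deletions-after x (refl ∷ τ) = gmap (x ∷_) (deletion-∷ x) (deletions-after _ τ)

⊆⇒deletions : ∀ {ys zs} → ys ⊆ zs → ys ≢ [] → Star Deletion zs ys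
⊆⇒deletions []         ys≢[] = ⊥-elim (ys≢[] refl)
⊆⇒deletions (z ∷ʳ τ)   ys≢[] = (zero , refl , λ { refl → ys≢[] (⊆[]⇒≡[] τ) }) ◅ ⊆⇒deletions τ ys≢[]
⊆⇒deletions (refl ∷ τ) _     = deletions-after _ τ

contract-head : ∀ c (D : Cycles) p → removeAt c p ≢ [] → contract (c ∷ D) zero p ≡ removeAt c p ∷ D
contract-head c D p ne with removeAt c p
... | []    = ⊥-elim (ne refl)
... | _ ∷ _ = refl

contract-suc : ∀ c (D : Cycles) i p → contract (c ∷ D) (suc i) p ≡ c ∷ contract D i p
contract-suc c D i p with removeAt (lookup D i) p
... | []    = refl
... | _ ∷ _ = refl

deletion⇒contractStep : ∀ (pre post : Cycles) {c c′} → Deletion c c′ →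
  ContractStep (pre ++ c ∷ post) (pre ++ c′ ∷ post)
deletion⇒contractStep []        post {c} (p , refl , ne) = zero , p , sym (contract-head c post p ne)
deletion⇒contractStep (c₀ ∷ pre) post δ with deletion⇒contractStep pre post δ
... | i , p , eq = suc i , p , trans (cong (c₀ ∷_) eq) (sym (contract-suc c₀ (pre ++ _ ∷ post) i p))

⊆⇒contractions : ∀ (pre post : Cycles) {c c′} → c′ ⊆ c → c′ ≢ [] →
  Star ContractStep (pre ++ c ∷ post) (pre ++ c′ ∷ post)
⊆⇒contractions pre post τ c′≢[] =
  gmap (λ c → pre ++ c ∷ post) (deletion⇒contractStep pre post) (⊆⇒deletions τ c′≢[])

splitAt-lookup : (xs : List A) (i : Fin (length xs)) →
  ∃₂ λ pre post → xs ≡ pre ++ lookup xs i ∷ post × removeAt xs i ≡ pre ++ post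
splitAt-lookup (x ∷ xs) zero    = [] , xs , refl , refl
splitAt-lookup (x ∷ xs) (suc i) with splitAt-lookup xs i
... | pre , post , eq₁ , eq₂ = x ∷ pre , post , cong (x ∷_) eq₁ , cong (x ∷_) eq₂

∈-concat⁻-lookup : (xss : List (List A)) {x : A} → x ∈ concat xss → ∃ λ j → x ∈ lookup xss j
∈-concat⁻-lookup (xs ∷ xss) x∈ with ∈-++⁻ xs x∈
... | inj₁ x∈xs  = zero , x∈xs
... | inj₂ x∈xss = Product.map suc id (∈-concat⁻-lookup xss x∈xss)

∈-concat-removeAt⁻ : (xss : List (List A)) (i : Fin (length xss)) {x : A} →
  x ∈ concat (removeAt xss i) → ∃ λ j → j ≢ i × x ∈ lookup xss j
∈-concat-removeAt⁻ (xs ∷ xss) zero x∈ with ∈-concat⁻-lookup xss x∈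
... | j , x∈j = suc j , (λ ()) , x∈j
∈-concat-removeAt⁻ (xs ∷ xss) (suc i) x∈ with ∈-++⁻ xs x∈
... | inj₁ x∈xs  = zero , (λ ()) , x∈xs
... | inj₂ x∈xss with ∈-concat-removeAt⁻ xss i x∈xss
...   | j , j≢i , x∈j = suc j , j≢i ∘ suc-injective , x∈j

∷-≅-insert : ∀ (pre post : Cycles) {c c′} → RotEq c c′ → (c ∷ pre ++ post) ≅ (pre ++ c′ ∷ post)
∷-≅-insert pre post {c} rot =
  pre ++ c ∷ post , ↭-sym (shift c pre post) ,
  Pointwise.++⁺ˡ (λ {c} → RotEq-refl c) pre (rot Pointwise.∷ Pointwise.refl (λ {c} → RotEq-refl c))

module Transposition (a b : Label) where

  swap : Label → Label
  swap x with x ≟ a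
  ... | yes _ = b
  ... | no _ with x ≟ b
  ...   | yes _ = a
  ...   | no _  = x

  swap-a : swap a ≡ b
  swap-a with a ≟ a
  ... | yes _  = refl
  ... | no a≢a = ⊥-elim (a≢a refl)

  swap-b : swap b ≡ a
  swap-b with b ≟ a
  ... | yes b≡a = b≡a
  ... | no _ with b ≟ b
  ...   | yes _  = refl
  ...   | no b≢b = ⊥-elim (b≢b refl)

  swap-fixes : ∀ {x} → x ≢ a → x ≢ b → swap x ≡ x
  swap-fixes {x} x≢a x≢b with x ≟ a
  ... | yes x≡a = ⊥-elim (x≢a x≡a)
  ... | no _ with x ≟ b
  ...   | yes x≡b = ⊥-elim (x≢b x≡b)
  ...   | no _    = refl

  swap-involutive : ∀ x → swap (swap x) ≡ x
  swap-involutive x with x ≟ a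
  ... | yes refl = swap-b
  ... | no x≢a with x ≟ b
  ...   | yes refl = swap-a
  ...   | no x≢b   = swap-fixes x≢a x≢b

  swap-injective : Injective _≡_ _≡_ swap
  swap-injective {x} {y} eq = begin
    x               ≡⟨ swap-involutive x ⟨
    swap (swap x)   ≡⟨ cong swap eq ⟩
    swap (swap y)   ≡⟨ swap-involutive y ⟩
    y               ∎
    where open ≡-Reasoning

  map-swap-fresh : ∀ {xs} → a ∉ xs → b ∉ xs → map swap xs ≡ xs
  map-swap-fresh a∉ b∉ = map-id-local (tabulate λ x∈ → swap-fixes (λ { refl → a∉ x∈ }) (λ { refl → b∉ x∈ }))

  map-map-swap-fresh : ∀ {xss} → a ∉ concat xss → b ∉ concat xss → map (map swap) xss ≡ xss
  map-map-swap-fresh a∉ b∉ = map-id-local (tabulate λ xs∈ →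
    map-swap-fresh (a∉ ∘ λ a∈ → ∈-concat⁺′ a∈ xs∈) (b∉ ∘ λ b∈ → ∈-concat⁺′ b∈ xs∈))

shortening-forbidden : ∀ (s : State) history i (ρ : Label → Label) → Injective _≡_ _≡_ ρ →
  ∀ {c c″} → c″ ⊆ lookup (cycles s) i → RotEq c c″ → c ≢ [] →
  ∀ s′ → counter s′ ≡ counter s → map (map ρ) (cycles s′) ≡ c ∷ removeAt (cycles s) i →
  Forbidden (s ∷ history) s′
shortening-forbidden s history i ρ ρ-injective {c} {c″} c″⊆ rot c≢[] s′ same-counter relabelled
  with splitAt-lookup (cycles s) i
... | pre , post , split , removed =
  s , here refl , ⟨ pre ++ c″ ∷ post , counter s ⟩ , (≤-refl , contractions) ,
  same-counter , ρ , ρ-injective , subst (_≅ (pre ++ c″ ∷ post)) (sym cycles≡) (∷-≅-insert pre post rot)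
  where
  contractions : Star ContractStep (cycles s) (pre ++ c″ ∷ post)
  contractions = subst (λ D → Star ContractStep D (pre ++ c″ ∷ post)) (sym split)
                   (⊆⇒contractions pre post c″⊆ (RotEq-≢[] rot c≢[]))
  cycles≡ : map (map ρ) (cycles s′) ≡ c ∷ pre ++ post
  cycles≡ = trans relabelled (cong (c ∷_) removed)

∈-segP′⁻ : ∀ (c : Cycle) v w {x} → x ∈ segP' c v w → x ∈ c
∈-segP′⁻ c v w = ∈-resp-↭ (rotate-↭ (toℕ w) c) ∘ Any-resp-⊆ (take-⊆ _ _)

gather-∈-Ĉ₁⇒∉segP′ : ∀ c v w {a b} → a ≢ b → Gather c v w a → a ∈ Ĉ₁ c v w b → a ∉ segP' c v w
gather-∈-Ĉ₁⇒∉segP′ _ _ _ _ (inj₁ (_ , a∉P′)) _ = a∉P′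
gather-∈-Ĉ₁⇒∉segP′ c v w a≢b (inj₂ (a∉P , _)) a∈Ĉ₁ with ∈-++⁻ (segP c v w) a∈Ĉ₁
... | inj₁ a∈P        = ⊥-elim (a∉P a∈P)
... | inj₂ (here a≡b) = ⊥-elim (a≢b a≡b)

lemma4p7 : (s : State) → IsGameState s → (earlier : List State)
    → (i : Fin (length (cycles s))) → (a : Label) → IsolatedOn (cycles s) i a
    → (v w : Fin (length (lookup (cycles s) i)))
    → Gather (lookup (cycles s) i) v w a
    → (b : Label) → b ∉ concat (cycles s)
    → a ∈ Ĉ₁ (lookup (cycles s) i) v w b
    → ¬ LegalForRestricted (s ∷ earlier) (moveC s i v w b)
lemma4p7 s _ earlier i a (a∈C , a-isolated) v w gathers b b-fresh a∈Ĉ₁ legal =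
  let c″ , c″⊆C , rot = ⊆-rotate (toℕ w) C (take-++-∷-⊆ _ _ a∉P′ (∈-rotate⁺ (toℕ w) a∈C))
  in legal (shortening-forbidden s earlier i swap swap-injective
              c″⊆C rot (++-[x]-≢[] P′) (moveC s i v w b) refl relabelled)
  where
  open Transposition a b
  C  = lookup (cycles s) i
  P′ = segP' C v w
  b∉C : b ∉ C
  b∉C b∈C = b-fresh (∈-concat⁺′ b∈C (∈-lookup {xs = cycles s} i))
  a∉P′ : a ∉ P′
  a∉P′ = gather-∈-Ĉ₁⇒∉segP′ C v w (λ { refl → b∉C a∈C }) gathers a∈Ĉ₁
  a∉rest : a ∉ concat (removeAt (cycles s) i)
  a∉rest a∈ with ∈-concat-removeAt⁻ (cycles s) i a∈
  ... | j , j≢i , a∈j = a-isolated j j≢i a∈j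
  b∉rest : b ∉ concat (removeAt (cycles s) i)
  b∉rest b∈ with ∈-concat-removeAt⁻ (cycles s) i b∈
  ... | j , _ , b∈j = b-fresh (∈-concat⁺′ b∈j (∈-lookup {xs = cycles s} j))
  relabelled : map (map swap) (Ĉ₂ C v w b ∷ removeAt (cycles s) i) ≡ (P′ ++ [ a ]) ∷ removeAt (cycles s) i
  relabelled = cong₂ _∷_
    (trans (map-++ swap P′ [ b ]) (cong₂ _++_ (map-swap-fresh a∉P′ (b∉C ∘ ∈-segP′⁻ C v w)) (cong [_] swap-b)))
    (map-map-swap-fresh a∉rest b∉rest)
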